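{- Let $p$ be a prime number with $p\equiv \pm 7 \pmod{24}$. Then: (i) the $(\overline{2},\overline{4})$-dynomial minimal solution of $(E_{\mathbb{Z}/p\mathbb{Z}})$ is irreducible; (ii) the $(\overline{5},\overline{10})$-dynomial minimal solution of $(E_{\mathbb{Z}/p\mathbb{Z}})$ is irreducible.
   Context: $\overline{a}$ denotes the class of $a$ in $\mathbb{Z}/p\mathbb{Z}$. For a commutative unital ring $A$ and $a_1,\ldots,a_n\in A$ set $M_n(a_1,\ldots,a_n)=\begin{pmatrix} a_n & -1_A\\ 1_A & 0_A\end{pmatrix}\cdots\begin{pmatrix} a_1 & -1_A\\ 1_A & 0_A\end{pmatrix}$. An $n$-tuple is a solution of $(E_A)$ if $M_n(a_1,\ldots,a_n)=\pm \mathrm{Id}$. For tuples, $(a_1,\ldots,a_n)\oplus(b_1,\ldots,b_m)=(a_1+b_m,a_2,\ldots,a_{n-1},a_n+b_1,b_2,\ldots,b_{m-1})$. Write $(a_1,\ldots,a_n)\sim(b_1,\ldots,b_n)$ if $(b_1,\ldots,b_n)$ is obtained from $(a_1,\ldots,a_n)$ or from $(a_n,\ldots,a_1)$ by a cyclic permutation. A solution $(c_1,\ldots,c_n)$ with $n\geq 3$ is reducible if there exist a solution $(b_1,\ldots,b_l)$ and a tuple $(a_1,\ldots,a_m)$ with $l,m\geq 3$ and $(c_1,\ldots,c_n)\sim(a_1,\ldots,a_m)\oplus(b_1,\ldots,b_l)$; otherwise irreducible. For $A$ finite and $a\neq b$ in $A$, the $(a,b)$-dynomial minimal solution of $(E_A)$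 is the solution of the form $(a,b,\ldots,a,b)$ (pair $(a,b)$ repeated $k\geq1$ times) of minimal size. -}

module Defs where

open import Data.Nat as ℕ using (ℕ; zero; suc; _≤_; _<_)
open import Data.Integer as ℤ using (ℤ; +_; _+_; _*_; _-_; -_)
open import Data.Integer.Divisibility using (_∣_)
open import Data.List using (List; []; _∷_; length; reverse; drop; take; _++_; replicate; concat; foldl)
open import Data.List.Relation.Binary.Pointwise using (Pointwise)
open import Data.Product using (Σ; _×_; ∃; ∃-syntax)
open import Data.Sum using (_⊎_)
open import Relation.Nullary using (¬_)

-- Elements of ℤ/pℤ are represented by integers; equality in ℤ/pℤ is
-- congruence modulo p (the quotient presented as a setoid).
_≡[_]_ : ℤ → ℕ → ℤ → Set
x ≡[ p ] y = (+ p) ∣ (x - y)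

record Mat : Set where
  constructor mat
  field
    m11 m12 m21 m22 : ℤ

_⊗_ : Mat → Mat → Mat
mat a b c d ⊗ mat e f g h = mat (a * e + b * g) (a * f + b * h) (c * e + d * g) (c * f + d * h)

Id : Mat
Id = mat (+ 1) (+ 0) (+ 0) (+ 1)

Elem : ℤ → Mat
Elem a = mat a (- (+ 1)) (+ 1) (+ 0)

-- M_n(a_1,…,a_n) = Elem a_n ⊗ … ⊗ Elem a_1
M : List ℤ → Mat
M = foldl (λ acc a → Elem a ⊗ acc) Id

_≈M[_]_ : Mat → ℕ → Mat → Set
mat a b c d ≈M[ p ] mat e f g h =
  (a ≡[ p ] e) × (b ≡[ p ] f) × (c ≡[ p ] g) × (d ≡[ p ] h)

negM : Mat → Mat
negM (mat a b c d) = mat (- a) (- b) (- c) (- d)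

Solution : ℕ → List ℤ → Set
Solution p as = (M as ≈M[ p ] Id) ⊎ (M as ≈M[ p ] negM Id)

_≈L[_]_ : List ℤ → ℕ → List ℤ → Set
as ≈L[ p ] bs = Pointwise (λ x y → x ≡[ p ] y) as bs

head0 : List ℤ → ℤ
head0 [] = + 0
head0 (x ∷ _) = x

tail' : List ℤ → List ℤ
tail' [] = []
tail' (_ ∷ xs) = xs

last0 : List ℤ → ℤ
last0 [] = + 0
last0 (x ∷ []) = x
last0 (_ ∷ y ∷ ys) = last0 (y ∷ ys)

init' : List ℤ → List ℤ
init' [] = []
init' (x ∷ []) = []
init' (x ∷ y ∷ ys) = x ∷ init' (y ∷ ys)

-- (a_1,…,a_m) ⊕ (b_1,…,b_l)
--   = (a_1 + b_l, a_2, …, a_{m-1}, a_m + b_1, b_2, …, b_{l-1})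
-- (only used for m, l ≥ 3)
_⊕_ : List ℤ → List ℤ → List ℤ
as ⊕ bs =
  ((head0 as + last0 bs) ∷ init' (tail' as))
  ++ ((last0 as + head0 bs) ∷ init' (tail' bs))

rotate : ℕ → List ℤ → List ℤ
rotate i xs = drop i xs ++ take i xs

_∼[_]_ : List ℤ → ℕ → List ℤ → Set
as ∼[ p ] bs =
  ∃[ i ] ((bs ≈L[ p ] rotate i as) ⊎ (bs ≈L[ p ] rotate i (reverse as)))

Reducible : ℕ → List ℤ → Set
Reducible p cs =
  ∃[ as ] ∃[ bs ] (Solution p bs × 3 ≤ length bs × 3 ≤ length as
                   × (cs ∼[ p ] (as ⊕ bs)))

Irreducible : ℕ → List ℤ → Set
Irreducible p cs = Solution p cs × 3 ≤ length cs × ¬ Reducible p cs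

dyn : ℤ → ℤ → ℕ → List ℤ
dyn a b k = concat (replicate k (a ∷ b ∷ []))

IsDynMinimal : ℕ → ℤ → ℤ → ℕ → Set
IsDynMinimal p a b k =
  1 ≤ k × Solution p (dyn a b k)
  × (∀ j → 1 ≤ j → j < k → ¬ Solution p (dyn a b j))

{-# OPTIONS --safe #-}
module Submission where

-- Put t = ab − 2 and let U be given by U₀ = 0, U₁ = 1, U_{n+2} = t U_{n+1} − U_n, so that
-- U_{n+1}² − t U_{n+1} U_n + U_n² = 1. The monodromy of (a, b, …, a, b) with j pairs has
-- (1,1)-entry U_{j+1} + U_j, and that of (b, a, b, …, a, b) with j pairs after the first b has
-- (1,1)-entry b U_{j+1}; minimality of the dynomial solution of size 2k forces p ∤ U_m for 0 < m < k.
--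
-- If the solution were ∼ (a₁, …, a_m) ⊕ (b₁, …, b_l) with the second summand a solution, the
-- interior (b₂, …, b_{l−1}) would be an alternating block of the cyclic word, missing at least three
-- of its letters, whose monodromy has (1,1)-entry ±1 (it is minus the (2,2)-entry of ±Id). For a
-- block of even length 2j this gives (U_{j+1} + U_j)² ≡ 1, i.e. p | ab U_j U_{j+1}, which minimality
-- excludes. For a block of odd length starting with y ∈ {a, b}, y U_m ≡ ±1 makes
-- W = y (2 U_{m+1} − t U_m) a square root of 4y² + t² − 4 modulo p. This is 3·4², 6·4² for (2, 4)
-- and 6·20², 3·30² for (5, 10), whereas 3 and 6 are quadratic non-residues modulo p ≡ ±7 (mod 24).
--
-- The non-residue property is proved without reciprocity: by Thue's lemma a square root of c
-- modulo p yields A² ≡ c B² (mod p) with 0 < A² + B² and A², B² < p, so c B² − A² is one of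
-- 0, p, …, (c − 1) p. The first case contradicts the irrationality of √c, the others are ruled out
-- by congruences modulo 24, 48, 72 and 96.

open import Defs
open import Data.Nat using (ℕ; _%_)
open import Data.Nat.Primality using (Prime)
open import Data.Integer using (+_)
open import Data.Product using (_×_; _,_)
open import Data.Sum using (_⊎_)
open import Relation.Binary.PropositionalEquality using (_≡_; refl)

module Descent where

  open import Data.Nat.Base
  open import Data.Nat.Properties
  open import Data.Nat.Divisibility
  open import Data.Nat.Primality using (prime⇒nonZero; prime⇒nonTrivial; euclidsLemma)
  open import Data.Nat.Induction using (<-rec)
  open import Data.Nat.Tactic.RingSolver using (solve)
  open import Data.List.Base using ([]; _∷_)
  open import Data.Product using (∃-syntax)
  open import Data.Sum using ([_,_]′)
  open import Function using (id)
  open import Relation.Binary.PropositionalEquality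
  open import Relation.Nullary using (contradiction)

  module _ {q : ℕ} (q-prime : Prime q) where
    private instance q≢0 = prime⇒nonZero q-prime

    prime∣m*m⇒∣m : ∀ {m} → q ∣ m * m → q ∣ m
    prime∣m*m⇒∣m {m} q∣m*m = [ id , id ]′ (euclidsLemma m m q-prime q∣m*m)

    private
      [aq]²≡qdB²⇒qa²≡dB² : ∀ a {d} B → (a * q) * (a * q) ≡ q * d * (B * B) → q * (a * a) ≡ d * (B * B)
      [aq]²≡qdB²⇒qa²≡dB² a {d} B eq = *-cancelˡ-≡ _ _ q (begin
        q * (q * (a * a))     ≡⟨ solve (q ∷ a ∷ []) ⟩
        (a * q) * (a * q)     ≡⟨ eq ⟩
        q * d * (B * B)       ≡⟨ *-assoc q d (B * B) ⟩
        q * (d * (B * B))     ∎)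
        where open ≡-Reasoning

      [aq]²≡qdB²⇒q∣B*B : ∀ a {d} B → q ∤ d → (a * q) * (a * q) ≡ q * d * (B * B) → q ∣ B * B
      [aq]²≡qdB²⇒q∣B*B a {d} B q∤d eq = [ (λ q∣d → contradiction q∣d q∤d) , id ]′ (euclidsLemma d (B * B) q-prime
        (divides (a * a) (trans (sym ([aq]²≡qdB²⇒qa²≡dB² a B eq)) (*-comm q (a * a)))))

    A*A≡q*d*B*B⇒q∣A∧q∣B : ∀ {d} → q ∤ d → ∀ {A B} → A * A ≡ q * d * (B * B) →
                          ∃[ a ] ∃[ b ] A ≡ a * q × B ≡ b * q × a * a ≡ q * d * (b * b)
    A*A≡q*d*B*B⇒q∣A∧q∣B {d} q∤d {A} {B} eq
      with divides a refl ← prime∣m*m⇒∣m {A} (divides (d * (B * B)) (trans eq (solve (q ∷ d ∷ B ∷ []))))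
      with divides b refl ← prime∣m*m⇒∣m {B} ([aq]²≡qdB²⇒q∣B*B a B q∤d eq)
      = a , b , refl , refl , *-cancelˡ-≡ _ _ q (begin
        q * (a * a)                 ≡⟨ [aq]²≡qdB²⇒qa²≡dB² a (b * q) eq ⟩
        d * ((b * q) * (b * q))     ≡⟨ solve (q ∷ d ∷ b ∷ []) ⟩
        q * (q * d * (b * b))       ∎)
        where open ≡-Reasoning

    A*A≡q*d*B*B⇒B≡0 : ∀ {d} → q ∤ d → ∀ B A → A * A ≡ q * d * (B * B) → B ≡ 0
    A*A≡q*d*B*B⇒B≡0 {d} q∤d = <-rec _ descend
      where
      descend : ∀ B → (∀ {b} → b < B → ∀ a → a * a ≡ q * d * (b * b) → b ≡ 0) →
                ∀ A → A * A ≡ q * d * (B * B) → B ≡ 0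
      descend B ih A eq with A*A≡q*d*B*B⇒q∣A∧q∣B q∤d {A} eq
      ... | a , zero      , _ , B≡0  , _       = B≡0
      ... | a , b@(suc _) , _ , refl , a²≡qdb² =
        contradiction (ih (m<m*n b q (nonTrivial⇒n>1 q {{prime⇒nonTrivial q-prime}})) a a²≡qdb²) λ ()

module ModularObstruction where

  open import Data.Nat.Base
  open import Data.Nat.Properties using (≡⇒≡ᵇ; ≤-trans; m≤m+n)
  open import Data.Nat.DivMod using (%-distribˡ-+; %-distribˡ-*; m%n%n≡m%n; m%n<n; m%n≤m; m∣n⇒o%n%m≡o%m)
  open import Data.Nat.Divisibility using (_∣_; divides)
  open import Data.Bool.Base using (Bool; true; false; T; not; _∧_; _∨_)
  open import Data.Bool.Properties using (T-∧)
  open import Data.Bool.ListAction using (all)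
  open import Data.List.Base using (upTo)
  open import Data.List.Relation.Unary.All using (lookup)
  open import Data.List.Relation.Unary.All.Properties using (all⁺)
  open import Data.List.Membership.Propositional.Properties using (∈-upTo⁺)
  open import Data.Sum using (inj₁; inj₂)
  open import Function using (Equivalence)
  open import Relation.Binary.PropositionalEquality
  open import Relation.Nullary using (¬_)

  private
    T-all-upTo : ∀ {f n} → T (all f (upTo n)) → ∀ {i} → i < n → T (f i)
    T-all-upTo {f} {n} t i<n = lookup (all⁺ f (upTo n) t) (∈-upTo⁺ i<n)

    T-not⇒¬T : ∀ {b} → T (not b) → ¬ T b
    T-not⇒¬T {true}  ()
    T-not⇒¬T {false} _ ()

  module _ {M : ℕ} .{{_ : NonZero M}} where

    %-cong-+ : ∀ {x x' y y'} → x % M ≡ x' % M → y % M ≡ y' % M → (x + y) % M ≡ (x' + y') % M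
    %-cong-+ {x} {x'} {y} {y'} eqx eqy = begin
      (x + y) % M               ≡⟨ %-distribˡ-+ x y M ⟩
      (x % M + y % M) % M       ≡⟨ cong₂ (λ u v → (u + v) % M) eqx eqy ⟩
      (x' % M + y' % M) % M     ≡⟨ %-distribˡ-+ x' y' M ⟨
      (x' + y') % M             ∎
      where open ≡-Reasoning

    %-cong-* : ∀ {x x' y y'} → x % M ≡ x' % M → y % M ≡ y' % M → (x * y) % M ≡ (x' * y') % M
    %-cong-* {x} {x'} {y} {y'} eqx eqy = begin
      (x * y) % M               ≡⟨ %-distribˡ-* x y M ⟩
      (x % M * (y % M)) % M     ≡⟨ cong₂ (λ u v → (u * v) % M) eqx eqy ⟩
      (x' % M * (y' % M)) % M   ≡⟨ %-distribˡ-* x' y' M ⟨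
      (x' * y') % M             ∎
      where open ≡-Reasoning

  ≡±7[24] : ℕ → Set
  ≡±7[24] q = q % 24 ≡ 7 ⊎ q % 24 ≡ 17

  ≡±7[24]ᵇ : ℕ → Bool
  ≡±7[24]ᵇ q = (q % 24 ≡ᵇ 7) ∨ (q % 24 ≡ᵇ 17)

  ≡±7[24]⇒T : ∀ q → ≡±7[24] q → T (≡±7[24]ᵇ q)
  ≡±7[24]⇒T _ (inj₁ q%24≡7)  rewrite q%24≡7  = _
  ≡±7[24]⇒T _ (inj₂ q%24≡17) rewrite q%24≡17 = _

  ≡±7[24]⇒7≤ : ∀ {q} → ≡±7[24] q → 7 ≤ q
  ≡±7[24]⇒7≤ {q} (inj₁ q%24≡7)  = subst (_≤ q) q%24≡7 (m%n≤m q 24)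
  ≡±7[24]⇒7≤ {q} (inj₂ q%24≡17) = ≤-trans (m≤m+n 7 10) (subst (_≤ q) q%24≡17 (m%n≤m q 24))

  unsolvableMod : (M c j : ℕ) .{{_ : NonZero M}} → Bool
  unsolvableMod M c j = all (λ a → all (λ b → all (λ r →
    not (≡±7[24]ᵇ r ∧ (c * (b * b) % M ≡ᵇ (a * a + j * r) % M))) (upTo M)) (upTo M)) (upTo M)

  unsolvableMod⇒c*B*B≢A*A+j*q : ∀ M c j .{{_ : NonZero M}} → 24 ∣ M → T (unsolvableMod M c j) →
                                 ∀ q → ≡±7[24] q → ∀ A B → c * (B * B) ≢ A * A + j * q
  unsolvableMod⇒c*B*B≢A*A+j*q M c j 24∣M unsolvable q q≡±7 A B eq =
    T-not⇒¬T (T-all-upTo (T-all-upTo (T-all-upTo unsolvable (m%n<n A M)) (m%n<n B M)) (m%n<n q M))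
      (Equivalence.from T-∧ (r≡±7 , ≡⇒≡ᵇ _ _ eq-mod-M))
    where
    r≡±7 : T (≡±7[24]ᵇ (q % M))
    r≡±7 rewrite m∣n⇒o%n%m≡o%m 24 M q 24∣M = ≡±7[24]⇒T q q≡±7
    %-idem : ∀ x → x % M ≡ (x % M) % M
    %-idem x = sym (m%n%n≡m%n x M)
    eq-mod-M : c * (B % M * (B % M)) % M ≡ (A % M * (A % M) + j * (q % M)) % M
    eq-mod-M = begin
      c * (B % M * (B % M)) % M            ≡⟨ %-cong-* {x = c} refl (%-cong-* (m%n%n≡m%n B M) (m%n%n≡m%n B M)) ⟩
      c * (B * B) % M                      ≡⟨ cong (_% M) eq ⟩
      (A * A + j * q) % M                  ≡⟨ %-cong-+ (%-cong-* (%-idem A) (%-idem A)) (%-cong-* {x = j} refl (%-idem q)) ⟩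
      (A % M * (A % M) + j * (q % M)) % M  ∎
      where open ≡-Reasoning

  3*B*B≢A*A+j*q : ∀ q → ≡±7[24] q → ∀ A B j → 0 < j → j < 3 → 3 * (B * B) ≢ A * A + j * q
  3*B*B≢A*A+j*q q q≡±7 A B 1 _ _ = unsolvableMod⇒c*B*B≢A*A+j*q 24 3 1 (divides 1 refl) _ q q≡±7 A B
  3*B*B≢A*A+j*q q q≡±7 A B 2 _ _ = unsolvableMod⇒c*B*B≢A*A+j*q 24 3 2 (divides 1 refl) _ q q≡±7 A B
  3*B*B≢A*A+j*q _ _ _ _ (suc (suc (suc _))) _ (s≤s (s≤s (s≤s ())))

  6*B*B≢A*A+j*q : ∀ q → ≡±7[24] q → ∀ A B j → 0 < j → j < 6 → 6 * (B * B) ≢ A * A + j * q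
  6*B*B≢A*A+j*q q q≡±7 A B 1 _ _ = unsolvableMod⇒c*B*B≢A*A+j*q 24 6 1 (divides 1 refl) _ q q≡±7 A B
  6*B*B≢A*A+j*q q q≡±7 A B 2 _ _ = unsolvableMod⇒c*B*B≢A*A+j*q 48 6 2 (divides 2 refl) _ q q≡±7 A B
  6*B*B≢A*A+j*q q q≡±7 A B 3 _ _ = unsolvableMod⇒c*B*B≢A*A+j*q 72 6 3 (divides 3 refl) _ q q≡±7 A B
  6*B*B≢A*A+j*q q q≡±7 A B 4 _ _ = unsolvableMod⇒c*B*B≢A*A+j*q 96 6 4 (divides 4 refl) _ q q≡±7 A B
  6*B*B≢A*A+j*q q q≡±7 A B 5 _ _ = unsolvableMod⇒c*B*B≢A*A+j*q 24 6 5 (divides 1 refl) _ q q≡±7 A B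
  6*B*B≢A*A+j*q _ _ _ _ (suc (suc (suc (suc (suc (suc _)))))) _ (s≤s (s≤s (s≤s (s≤s (s≤s (s≤s ()))))))

module IntegerPrimeDivisors where

  open import Data.Nat.Base using (NonZero; _<_; _<ᵇ_; _≤_)
  open import Data.Nat.Properties using (<ᵇ⇒<; <-≤-trans; ≤-<-trans; <-irrefl)
  open import Data.Nat.Divisibility using (∣⇒≤) renaming (_∣_ to _∣ℕ_)
  open import Data.Nat.Primality using (euclidsLemma)
  open import Data.Integer.Base using (ℤ; ∣_∣; _*_)
  open import Data.Integer.Properties using (abs-*)
  open import Data.Integer.Divisibility.Signed using (_∣_; ∣⇒∣ᵤ; ∣ᵤ⇒∣)
  open import Data.Bool.Base using (T)
  open import Data.Sum using ([_,_]′; map)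
  open import Function using (_∘_)
  open import Relation.Binary.PropositionalEquality using (subst)
  open import Relation.Nullary using (¬_)

  module _ {p : ℕ} (p-prime : Prime p) where

    prime∣i*j⇒∣ : ∀ i j → + p ∣ i * j → (+ p ∣ i) ⊎ (+ p ∣ j)
    prime∣i*j⇒∣ i j p∣ij = map ∣ᵤ⇒∣ ∣ᵤ⇒∣ (euclidsLemma ∣ i ∣ ∣ j ∣ p-prime (subst (p ∣ℕ_) (abs-* i j) (∣⇒∣ᵤ p∣ij)))

    prime∤i∧∤j⇒∤i*j : ∀ {i j} → ¬ + p ∣ i → ¬ + p ∣ j → ¬ + p ∣ i * j
    prime∤i∧∤j⇒∤i*j {i} {j} p∤i p∤j = [ p∤i , p∤j ]′ ∘ prime∣i*j⇒∣ i j

  n<7≤p⇒p∤n : ∀ {p} → 7 ≤ p → ∀ n → .{{_ : NonZero n}} → T (n <ᵇ 7) → ¬ + p ∣ + n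
  n<7≤p⇒p∤n 7≤p n n<7 p∣n = <-irrefl refl (<-≤-trans (≤-<-trans (∣⇒≤ (∣⇒∣ᵤ p∣n)) (<ᵇ⇒< n 7 n<7)) 7≤p)

module Thue where

  open import Data.Nat.Base as ℕ using (zero; suc; _<_; _≤_; z≤n; s≤s; NonZero)
  import Data.Nat.Properties as ℕ
  open import Data.Nat.DivMod using (_/_; m%n<n; m<n*o⇒m/o<n; m≡m%n+[m/n]*n)
  import Data.Nat.Divisibility as ℕ
  open import Data.Nat.Primality using (prime⇒nonZero; prime⇒nonTrivial; prime⇒irreducible)
  open import Data.Integer.Base using (ℤ; ∣_∣; _+_; _-_; _*_; _%ℕ_; _/ℕ_; 0ℤ)
  import Data.Integer.Properties as ℤ
  open import Data.Integer.Divisibility.Signed using (_∣_; divides)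
  open import Data.Integer.DivMod using (n%ℕd<d; a≡a%ℕn+[a/ℕn]*n)
  open import Data.Integer.Tactic.RingSolver using (solve-∀)
  open import Data.Fin.Base using (Fin; toℕ; fromℕ<)
  open import Data.Fin.Properties using (pigeonhole; toℕ-fromℕ<; toℕ<n)
  open import Data.Product using (∃-syntax)
  open import Data.Sum using (inj₁; inj₂)
  open import Function using (_∘_)
  open import Relation.Binary.PropositionalEquality
  open import Relation.Nullary using (¬_; yes; no)

  ∃⌊√⌋ : ∀ n → ∃[ s ] s ℕ.* s ≤ n × n < suc s ℕ.* suc s
  ∃⌊√⌋ zero = 0 , z≤n , s≤s z≤n
  ∃⌊√⌋ (suc n) with s , s²≤n , n<[1+s]² ← ∃⌊√⌋ n | suc s ℕ.* suc s ℕ.≤? suc n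
  ... | yes [1+s]²≤1+n = suc s , [1+s]²≤1+n ,
        ℕ.≤-<-trans n<[1+s]² (ℕ.*-mono-< (ℕ.n<1+n (suc s)) (ℕ.n<1+n (suc s)))
  ... | no  [1+s]²≰1+n = s , ℕ.m≤n⇒m≤1+n s²≤n , ℕ.≰⇒> [1+s]²≰1+n

  ∣m-n∣≤s : ∀ {m n s} → m < suc s → n < suc s → ∣ + m - + n ∣ ≤ s
  ∣m-n∣≤s {m} {n} m<1+s n<1+s rewrite ℤ.m-n≡m⊖n m n =
    ℕ.≤-trans (ℤ.∣m⊝n∣≤m⊔n m n) (ℕ.⊔-lub (ℕ.m<1+n⇒m≤n m<1+s) (ℕ.m<1+n⇒m≤n n<1+s))

  record ThuePair (p : ℕ) (e W : ℤ) : Set where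
    constructor thuePair
    field
      X Y        : ℤ
      ∣X∣²<p     : ∣ X ∣ ℕ.* ∣ X ∣ < p
      ∣Y∣²<p     : ∣ Y ∣ ℕ.* ∣ Y ∣ < p
      nontrivial : ¬ (X ≡ 0ℤ × Y ≡ 0ℤ)
      p∣eX-WY    : + p ∣ e * X - W * Y

  module _ {p : ℕ} (p-prime : Prime p) where
    private instance p≢0 = prime⇒nonZero p-prime

    %ℕ-≡⇒∣- : ∀ a b → a %ℕ p ≡ b %ℕ p → + p ∣ a - b
    %ℕ-≡⇒∣- a b eq = divides (a /ℕ p - b /ℕ p) (begin
      a - b
        ≡⟨ cong₂ _-_ (a≡a%ℕn+[a/ℕn]*n a p) (a≡a%ℕn+[a/ℕn]*n b p) ⟩
      (+ (a %ℕ p) + a /ℕ p * + p) - (+ (b %ℕ p) + b /ℕ p * + p)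
        ≡⟨ cong (λ r → (+ (a %ℕ p) + a /ℕ p * + p) - (+ r + b /ℕ p * + p)) (sym eq) ⟩
      (+ (a %ℕ p) + a /ℕ p * + p) - (+ (a %ℕ p) + b /ℕ p * + p)
        ≡⟨ [r+xq]-[r+yq]≡[x-y]q (+ (a %ℕ p)) (a /ℕ p) (b /ℕ p) (+ p) ⟩
      (a /ℕ p - b /ℕ p) * + p ∎)
      where
      open ≡-Reasoning
      [r+xq]-[r+yq]≡[x-y]q : ∀ r x y q → (r + x * q) - (r + y * q) ≡ (x - y) * q
      [r+xq]-[r+yq]≡[x-y]q = solve-∀

    1<p : 1 < p
    1<p = ℕ.nonTrivial⇒n>1 p {{prime⇒nonTrivial p-prime}}

    s*s≢p : ∀ s → s ℕ.* s ≢ p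
    s*s≢p s s²≡p with prime⇒irreducible p-prime (ℕ.divides s (sym s²≡p))
    ... | inj₁ refl = ℕ.<-irrefl s²≡p 1<p
    ... | inj₂ refl = ℕ.<-irrefl (sym (ℕ.*-cancelˡ-≡ p 1 p (trans s²≡p (sym (ℕ.*-identityʳ p))))) 1<p

    private module Box (e W : ℤ) (n : ℕ) .{{_ : NonZero n}} where
      x y : Fin (n ℕ.* n) → ℕ
      x i = toℕ i % n
      y i = toℕ i / n

      x<n : ∀ i → x i < n
      x<n i = m%n<n (toℕ i) n

      y<n : ∀ i → y i < n
      y<n i = m<n*o⇒m/o<n (toℕ<n i)

      x,y-injective : ∀ i j → x i ≡ x j → y i ≡ y j → toℕ i ≡ toℕ j
      x,y-injective i j xi≡xj yi≡yj = begin
        toℕ i                ≡⟨ m≡m%n+[m/n]*n (toℕ i) n ⟩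
        x i ℕ.+ y i ℕ.* n    ≡⟨ cong₂ (λ u v → u ℕ.+ v ℕ.* n) xi≡xj yi≡yj ⟩
        x j ℕ.+ y j ℕ.* n    ≡⟨ m≡m%n+[m/n]*n (toℕ j) n ⟨
        toℕ j                ∎
        where open ≡-Reasoning

      g : Fin (n ℕ.* n) → ℤ
      g i = e * + x i - W * + y i

      residue : Fin (n ℕ.* n) → Fin p
      residue i = fromℕ< (n%ℕd<d (g i) p)

      residue-≡⇒p∣g-g : ∀ i j → residue i ≡ residue j → + p ∣ g i - g j
      residue-≡⇒p∣g-g i j ri≡rj = %ℕ-≡⇒∣- (g i) (g j) (begin
        g i %ℕ p          ≡⟨ toℕ-fromℕ< (n%ℕd<d (g i) p) ⟨
        toℕ (residue i)   ≡⟨ cong toℕ ri≡rj ⟩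
        toℕ (residue j)   ≡⟨ toℕ-fromℕ< (n%ℕd<d (g j) p) ⟩
        g j %ℕ p          ∎)
        where open ≡-Reasoning

    private
      [ea-Wc]-[eb-Wd]≡e[a-b]-W[c-d] : ∀ e W a b c d → (e * a - W * c) - (e * b - W * d) ≡ e * (a - b) - W * (c - d)
      [ea-Wc]-[eb-Wd]≡e[a-b]-W[c-d] = solve-∀

    thue : ∀ e W → ThuePair p e W
    thue e W with s , s²≤p , p<[1+s]² ← ∃⌊√⌋ p
             with i , j , i<j , ri≡rj ← pigeonhole p<[1+s]² (Box.residue e W (suc s))
      = thuePair X Y (square<p (x<n i) (x<n j)) (square<p (y<n i) (y<n j)) X≢0∨Y≢0
          (subst (+ p ∣_) ([ea-Wc]-[eb-Wd]≡e[a-b]-W[c-d] e W _ _ _ _) (residue-≡⇒p∣g-g i j ri≡rj))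
      where
      open Box e W (suc s)
      X Y : ℤ
      X = + x i - + x j
      Y = + y i - + y j
      square<p : ∀ {m n} → m < suc s → n < suc s → ∣ + m - + n ∣ ℕ.* ∣ + m - + n ∣ < p
      square<p m<1+s n<1+s = ℕ.≤-<-trans (ℕ.*-mono-≤ (∣m-n∣≤s m<1+s n<1+s) (∣m-n∣≤s m<1+s n<1+s)) (ℕ.≤∧≢⇒< s²≤p (s*s≢p s))
      X≢0∨Y≢0 : ¬ (X ≡ 0ℤ × Y ≡ 0ℤ)
      X≢0∨Y≢0 (X≡0 , Y≡0) = ℕ.<-irrefl (x,y-injective i j (+m-+n≡0⇒m≡n X≡0) (+m-+n≡0⇒m≡n Y≡0)) i<j
        where
        +m-+n≡0⇒m≡n : ∀ {m n} → + m - + n ≡ 0ℤ → m ≡ n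
        +m-+n≡0⇒m≡n = ℤ.+-injective ∘ ℤ.i-j≡0⇒i≡j _ _

module QuadraticNonResidues where

  open import Data.Nat.Base as ℕ using (zero; suc; _<_; z<s; NonZero)
  import Data.Nat.Properties as ℕ
  import Data.Nat.Divisibility as ℕ
  open import Data.Integer.Base using (ℤ; -[1+_]; ∣_∣; _+_; _-_; _*_)
  import Data.Integer.Properties as ℤ
  open import Data.Integer.Divisibility.Signed using (_∣_; ∣⇒∣ᵤ; ∣m∣n⇒∣m+n; ∣m⇒∣m*n)
  open import Data.Integer.Tactic.RingSolver using (solve-∀)
  open import Data.Product using (∃-syntax)
  open import Data.Sum using (inj₁; inj₂; [_,_]′)
  open import Function using (id)
  open import Relation.Binary.PropositionalEquality
  open import Relation.Nullary using (¬_; yes; no; contradiction)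

  open IntegerPrimeDivisors using (prime∣i*j⇒∣; prime∤i∧∤j⇒∤i*j)
  open Thue using (ThuePair; thuePair; thue)

  QuadraticNonResidue : ℕ → ℕ → Set
  QuadraticNonResidue p c = ∀ e W → ¬ + p ∣ e → ¬ + p ∣ W * W - e * e * + c

  m∣n∧n<m⇒n≡0 : ∀ {m n} → m ℕ.∣ n → n < m → n ≡ 0
  m∣n∧n<m⇒n≡0 {n = zero}  _   _   = refl
  m∣n∧n<m⇒n≡0 {n = suc _} m∣n n<m = contradiction (ℕ.∣⇒≤ m∣n) (ℕ.<⇒≱ n<m)

  p∣u-v⇒u≡v⊎v≡u+jp : ∀ {p c u v} → + p ∣ + u - + v → u < p → v < c ℕ.* p →
                     u ≡ v ⊎ ∃[ j ] 0 < j × j < c × v ≡ u ℕ.+ j ℕ.* p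
  p∣u-v⇒u≡v⊎v≡u+jp {p} {c} {u} {v} p∣u-v u<p v<cp
    with p∣∣u⊖v∣ ← subst (λ i → p ℕ.∣ ∣ i ∣) (ℤ.m-n≡m⊖n u v) (∣⇒∣ᵤ p∣u-v) | u ℕ.<? v
  ... | no u≮v = inj₁ (ℕ.≤-antisym (ℕ.m∸n≡0⇒m≤n u∸v≡0) v≤u)
    where
    v≤u : v ℕ.≤ u
    v≤u = ℕ.≮⇒≥ u≮v
    u∸v≡0 : u ℕ.∸ v ≡ 0
    u∸v≡0 = m∣n∧n<m⇒n≡0 (subst (p ℕ.∣_) (trans (ℤ.∣m⊖n∣≡∣n⊖m∣ u v) (ℤ.∣⊖∣-≤ v≤u)) p∣∣u⊖v∣)
                        (ℕ.≤-<-trans (ℕ.m∸n≤m u v) u<p)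
  ... | yes u<v with ℕ.divides j v∸u≡jp ← subst (p ℕ.∣_) (ℤ.∣⊖∣-< u<v) p∣∣u⊖v∣ =
    inj₂ (j , 0<j j v∸u≡jp , j<c , trans (sym (ℕ.m+[n∸m]≡n (ℕ.<⇒≤ u<v))) (cong (u ℕ.+_) v∸u≡jp))
    where
    0<j : ∀ j → v ℕ.∸ u ≡ j ℕ.* p → 0 < j
    0<j zero    v∸u≡0 = contradiction (ℕ.m∸n≡0⇒m≤n v∸u≡0) (ℕ.<⇒≱ u<v)
    0<j (suc _) _     = z<s
    j<c : j < c
    j<c = ℕ.*-cancelʳ-< p j c (ℕ.≤-<-trans (subst (ℕ._≤ v) v∸u≡jp (ℕ.m∸n≤m v u)) v<cp)

  i*i≡+∣i∣*∣i∣ : ∀ i → i * i ≡ + (∣ i ∣ ℕ.* ∣ i ∣)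
  i*i≡+∣i∣*∣i∣ (+ n)    = sym (ℤ.pos-* n n)
  i*i≡+∣i∣*∣i∣ -[1+ n ] = refl

  module _ {p : ℕ} (p-prime : Prime p) {c : ℕ} .{{_ : NonZero c}}
           (√c∉ℚ : ∀ B A → A ℕ.* A ≡ c ℕ.* (B ℕ.* B) → B ≡ 0)
           (c*B*B≢A*A+j*p : ∀ A B j → 0 < j → j < c → c ℕ.* (B ℕ.* B) ≢ A ℕ.* A ℕ.+ j ℕ.* p) where

    private
      e²[X²-cY²]≡[eX-WY][eX+WY]+[W²-e²c]Y² : ∀ e W X Y c →
        e * e * (X * X - c * (Y * Y)) ≡ (e * X - W * Y) * (e * X + W * Y) + (W * W - e * e * c) * (Y * Y)
      e²[X²-cY²]≡[eX-WY][eX+WY]+[W²-e²c]Y² = solve-∀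

      p∣∣X∣²-c∣Y∣² : ∀ e W X Y → ¬ + p ∣ e → + p ∣ W * W - e * e * + c → + p ∣ e * X - W * Y →
                     + p ∣ + (∣ X ∣ ℕ.* ∣ X ∣) - + (c ℕ.* (∣ Y ∣ ℕ.* ∣ Y ∣))
      p∣∣X∣²-c∣Y∣² e W X Y p∤e p∣W²-e²c p∣eX-WY =
        subst (+ p ∣_) (cong₂ _-_ (i*i≡+∣i∣*∣i∣ X) (trans (cong (+ c *_) (i*i≡+∣i∣*∣i∣ Y)) (sym (ℤ.pos-* c _))))
          ([ contradiction′ , id ]′ (prime∣i*j⇒∣ p-prime (e * e) _
            (subst (+ p ∣_) (sym (e²[X²-cY²]≡[eX-WY][eX+WY]+[W²-e²c]Y² e W X Y (+ c)))
              (∣m∣n⇒∣m+n (∣m⇒∣m*n (e * X + W * Y) p∣eX-WY) (∣m⇒∣m*n (Y * Y) p∣W²-e²c)))))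
        where
        contradiction′ : ∀ {A : Set} → + p ∣ e * e → A
        contradiction′ p∣e² = contradiction p∣e² (prime∤i∧∤j⇒∤i*j p-prime p∤e p∤e)

    nonResidue : QuadraticNonResidue p c
    nonResidue e W p∤e p∣W²-e²c = no-ThuePair (thue p-prime e W)
      where
      no-ThuePair : ¬ ThuePair p e W
      no-ThuePair (thuePair X Y X²<p Y²<p X,Y≢0 p∣eX-WY) =
        [ equal-case , multiple-case ]′
          (p∣u-v⇒u≡v⊎v≡u+jp (p∣∣X∣²-c∣Y∣² e W X Y p∤e p∣W²-e²c p∣eX-WY) X²<p (ℕ.*-monoʳ-< c Y²<p))
        where
        equal-case : ¬ ∣ X ∣ ℕ.* ∣ X ∣ ≡ c ℕ.* (∣ Y ∣ ℕ.* ∣ Y ∣)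
        equal-case X²≡cY² = X,Y≢0 (ℤ.∣i∣≡0⇒i≡0 ∣X∣≡0 , ℤ.∣i∣≡0⇒i≡0 ∣Y∣≡0)
          where
          ∣Y∣≡0 : ∣ Y ∣ ≡ 0
          ∣Y∣≡0 = √c∉ℚ ∣ Y ∣ ∣ X ∣ X²≡cY²
          ∣X∣≡0 : ∣ X ∣ ≡ 0
          ∣X∣≡0 = [ id , id ]′ (ℕ.m*n≡0⇒m≡0∨n≡0 ∣ X ∣
                    (trans X²≡cY² (trans (cong (λ B → c ℕ.* (B ℕ.* B)) ∣Y∣≡0) (ℕ.*-zeroʳ c))))
        multiple-case : ¬ (∃[ j ] 0 < j × j < c × c ℕ.* (∣ Y ∣ ℕ.* ∣ Y ∣) ≡ ∣ X ∣ ℕ.* ∣ X ∣ ℕ.+ j ℕ.* p)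
        multiple-case (j , 0<j , j<c , cY²≡X²+jp) = c*B*B≢A*A+j*p ∣ X ∣ ∣ Y ∣ j 0<j j<c cY²≡X²+jp

module Monodromy where

  open import Data.Nat.Base using (zero; suc)
  open import Data.Integer.Base using (ℤ; _+_; _-_; _*_; -_)
  open import Data.Integer.Tactic.RingSolver using (solve-∀)
  open import Data.List.Base using (List; []; _∷_; _++_; foldl)
  open import Data.List.Properties using (foldl-++)
  open import Relation.Binary.PropositionalEquality

  mat-≡ : ∀ {a b c d a' b' c' d'} → a ≡ a' → b ≡ b' → c ≡ c' → d ≡ d' → mat a b c d ≡ mat a' b' c' d'
  mat-≡ refl refl refl refl = refl

  ⊗-assoc : ∀ A B C → A ⊗ (B ⊗ C) ≡ (A ⊗ B) ⊗ C
  ⊗-assoc (mat a b c d) (mat e f g h) (mat i j k l) =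
    mat-≡ (entry a b e f g h i k) (entry a b e f g h j l) (entry c d e f g h i k) (entry c d e f g h j l)
    where
    entry : ∀ a b e f g h i k → a * (e * i + f * k) + b * (g * i + h * k) ≡ (a * e + b * g) * i + (a * f + b * h) * k
    entry = solve-∀

  ⊗-identityˡ : ∀ A → Id ⊗ A ≡ A
  ⊗-identityˡ (mat a b c d) = mat-≡ (1a+0c≡a a c) (1a+0c≡a b d) (0a+1c≡c a c) (0a+1c≡c b d)
    where
    1a+0c≡a : ∀ a c → + 1 * a + + 0 * c ≡ a
    1a+0c≡a = solve-∀
    0a+1c≡c : ∀ a c → + 0 * a + + 1 * c ≡ c
    0a+1c≡c = solve-∀

  ⊗-identityʳ : ∀ A → A ⊗ Id ≡ A
  ⊗-identityʳ (mat a b c d) = mat-≡ (a1+b0≡a a b) (a0+b1≡b a b) (a1+b0≡a c d) (a0+b1≡b c d)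
    where
    a1+b0≡a : ∀ a b → a * + 1 + b * + 0 ≡ a
    a1+b0≡a = solve-∀
    a0+b1≡b : ∀ a b → a * + 0 + b * + 1 ≡ b
    a0+b1≡b = solve-∀

  private
    step : Mat → ℤ → Mat
    step acc a = Elem a ⊗ acc

  foldl-step-⊗ : ∀ A B xs → foldl step (A ⊗ B) xs ≡ foldl step A xs ⊗ B
  foldl-step-⊗ A B []       = refl
  foldl-step-⊗ A B (x ∷ xs) =
    trans (cong (λ C → foldl step C xs) (⊗-assoc (Elem x) A B)) (foldl-step-⊗ (Elem x ⊗ A) B xs)

  M-∷ : ∀ x xs → M (x ∷ xs) ≡ M xs ⊗ Elem x
  M-∷ x xs = begin
    foldl step (Elem x ⊗ Id) xs   ≡⟨ cong (λ C → foldl step C xs) (trans (⊗-identityʳ (Elem x)) (sym (⊗-identityˡ (Elem x)))) ⟩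
    foldl step (Id ⊗ Elem x) xs   ≡⟨ foldl-step-⊗ Id (Elem x) xs ⟩
    M xs ⊗ Elem x                 ∎
    where open ≡-Reasoning

  M-∷ʳ : ∀ xs x → M (xs ++ x ∷ []) ≡ Elem x ⊗ M xs
  M-∷ʳ xs x = foldl-++ step Id xs (x ∷ [])

  _⊗Elem_ : Mat → ℤ → Mat
  mat a b c d ⊗Elem z = mat (a * z + b) (- a) (c * z + d) (- c)

  ⊗-Elem : ∀ A z → A ⊗ Elem z ≡ A ⊗Elem z
  ⊗-Elem (mat a b c d) z = mat-≡ (az+b1≡az+b a b z) (a[-1]+b0≡-a a b) (az+b1≡az+b c d z) (a[-1]+b0≡-a c d)
    where
    az+b1≡az+b : ∀ a b z → a * z + b * + 1 ≡ a * z + b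
    az+b1≡az+b = solve-∀
    a[-1]+b0≡-a : ∀ a b → a * - (+ 1) + b * + 0 ≡ - a
    a[-1]+b0≡-a = solve-∀

  M-∷-⊗Elem : ∀ z zs → M (z ∷ zs) ≡ M zs ⊗Elem z
  M-∷-⊗Elem z zs = trans (M-∷ z zs) (⊗-Elem (M zs) z)

  m22-M-∷-∷ʳ : ∀ b mid b' → Mat.m22 (M (b ∷ mid ++ b' ∷ [])) ≡ - Mat.m11 (M mid)
  m22-M-∷-∷ʳ b mid b' = begin
    Mat.m22 (M (b ∷ mid ++ b' ∷ []))     ≡⟨ cong Mat.m22 (M-∷-⊗Elem b (mid ++ b' ∷ [])) ⟩
    Mat.m22 (M (mid ++ b' ∷ []) ⊗Elem b)  ≡⟨ cong (λ A → Mat.m22 (A ⊗Elem b)) (M-∷ʳ mid b') ⟩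
    Mat.m22 ((Elem b' ⊗ M mid) ⊗Elem b)   ≡⟨ -[1a+0c]≡-a (Mat.m11 (M mid)) (Mat.m21 (M mid)) ⟩
    - Mat.m11 (M mid)                     ∎
    where
    open ≡-Reasoning
    -[1a+0c]≡-a : ∀ a c → - (+ 1 * a + + 0 * c) ≡ - a
    -[1a+0c]≡-a = solve-∀

  -- U t n is the Chebyshev polynomial of the second kind U_{n-1}(t/2).
  U : ℤ → ℕ → ℤ
  U t zero          = + 0
  U t (suc zero)    = + 1
  U t (suc (suc n)) = t * U t (suc n) - U t n

  U-invariant : ∀ t n → U t (suc n) * U t (suc n) - t * U t (suc n) * U t n + U t n * U t n ≡ + 1
  U-invariant t zero    = base t
    where
    base : ∀ t → + 1 * + 1 - t * + 1 * + 0 + + 0 * + 0 ≡ + 1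
    base = solve-∀
  U-invariant t (suc n) = trans (step-invariant t (U t (suc n)) (U t n)) (U-invariant t n)
    where
    step-invariant : ∀ t v u → (t * v - u) * (t * v - u) - t * (t * v - u) * v + v * v ≡ v * v - t * v * u + u * u
    step-invariant = solve-∀

  -- The trace of M (x ∷ y ∷ []).
  tr : ℤ → ℤ → ℤ
  tr x y = x * y - + 2

  dynMat : ℤ → ℤ → ℕ → Mat
  dynMat x y j = mat (v + u) (- (y * u)) (x * u) (v - (x * y - + 1) * u)
    where
    u v : ℤ
    u = U (tr x y) j
    v = U (tr x y) (suc j)

  M-dyn : ∀ x y j → M (dyn x y j) ≡ dynMat x y j
  M-dyn x y zero = mat-≡ refl (0≡-[y0] y) (0≡x0 x) (1≡1-[xy-1]0 x y)
    where
    0≡-[y0] : ∀ y → + 0 ≡ - (y * + 0)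
    0≡-[y0] = solve-∀
    0≡x0 : ∀ x → + 0 ≡ x * + 0
    0≡x0 = solve-∀
    1≡1-[xy-1]0 : ∀ x y → + 1 ≡ + 1 - (x * y - + 1) * + 0
    1≡1-[xy-1]0 = solve-∀
  M-dyn x y (suc j) = begin
    M (x ∷ y ∷ dyn x y j)              ≡⟨ M-∷-⊗Elem x (y ∷ dyn x y j) ⟩
    M (y ∷ dyn x y j) ⊗Elem x          ≡⟨ cong (_⊗Elem x) (M-∷-⊗Elem y (dyn x y j)) ⟩
    (M (dyn x y j) ⊗Elem y) ⊗Elem x    ≡⟨ cong (λ A → (A ⊗Elem y) ⊗Elem x) (M-dyn x y j) ⟩
    (dynMat x y j ⊗Elem y) ⊗Elem x     ≡⟨ mat-≡ (m11 x y u v) (m12 x y u v) (m21 x y u v) (m22 x y u v) ⟩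
    dynMat x y (suc j)                 ∎
    where
    open ≡-Reasoning
    u v : ℤ
    u = U (tr x y) j
    v = U (tr x y) (suc j)
    m11 : ∀ x y u v → ((v + u) * y + - (y * u)) * x + - (v + u) ≡ ((x * y - + 2) * v - u) + v
    m11 = solve-∀
    m12 : ∀ x y u v → - ((v + u) * y + - (y * u)) ≡ - (y * v)
    m12 = solve-∀
    m21 : ∀ x y u v → ((x * u) * y + (v - (x * y - + 1) * u)) * x + - (x * u) ≡ x * v
    m21 = solve-∀
    m22 : ∀ x y u v → - ((x * u) * y + (v - (x * y - + 1) * u)) ≡ ((x * y - + 2) * v - u) - (x * y - + 1) * v
    m22 = solve-∀

  m11-M-∷-dyn : ∀ x y j → Mat.m11 (M (y ∷ dyn x y j)) ≡ y * U (tr x y) (suc j)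
  m11-M-∷-dyn x y j = begin
    Mat.m11 (M (y ∷ dyn x y j))        ≡⟨ cong Mat.m11 (M-∷-⊗Elem y (dyn x y j)) ⟩
    Mat.m11 (M (dyn x y j) ⊗Elem y)    ≡⟨ cong (λ A → Mat.m11 (A ⊗Elem y)) (M-dyn x y j) ⟩
    Mat.m11 (dynMat x y j ⊗Elem y)     ≡⟨ [v+u]y-yu≡yv y (U (tr x y) j) (U (tr x y) (suc j)) ⟩
    y * U (tr x y) (suc j)             ∎
    where
    open ≡-Reasoning
    [v+u]y-yu≡yv : ∀ y u v → (v + u) * y + - (y * u) ≡ y * v
    [v+u]y-yu≡yv = solve-∀

module Congruence (p : ℕ) where

  open import Data.Integer.Base using (ℤ; _+_; _-_; _*_; -_)
  open import Data.Integer.Properties using (neg-involutive)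
  open import Data.Integer.Divisibility.Signed
    using (_∣_; divides; ∣⇒∣ᵤ; ∣ᵤ⇒∣; ∣m∣n⇒∣m+n; ∣m⇒∣m*n; ∣n⇒∣m*n; ∣m⇒∣-m)
  open import Data.Integer.Tactic.RingSolver using (solve-∀)
  open import Data.List.Base using (_∷_; foldl)
  open import Data.List.Relation.Binary.Pointwise using ([]; _∷_)
  open import Data.Sum using (inj₁; inj₂; map)
  open import Relation.Binary.PropositionalEquality

  open IntegerPrimeDivisors using (prime∣i*j⇒∣)

  private
    x-x≡0*0 : ∀ x → x - x ≡ + 0 * + 0
    x-x≡0*0 = solve-∀
    y-x≡-1*[x-y] : ∀ x y → y - x ≡ - + 1 * (x - y)
    y-x≡-1*[x-y] = solve-∀
    x-z≡[x-y]+[y-z] : ∀ x y z → x - z ≡ (x - y) + (y - z)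
    x-z≡[x-y]+[y-z] = solve-∀
    [x+y]-[x'+y']≡[x-x']+[y-y'] : ∀ x y x' y' → (x + y) - (x' + y') ≡ (x - x') + (y - y')
    [x+y]-[x'+y']≡[x-x']+[y-y'] = solve-∀
    xy-x'y'≡x[y-y']+[x-x']y' : ∀ x y x' y' → x * y - x' * y' ≡ x * (y - y') + (x - x') * y'
    xy-x'y'≡x[y-y']+[x-x']y' = solve-∀
    [-x]-[-y]≡-[x-y] : ∀ x y → (- x) - (- y) ≡ - (x - y)
    [-x]-[-y]≡-[x-y] = solve-∀
    x-0≡x : ∀ x → x - + 0 ≡ x
    x-0≡x = solve-∀
    x²-1≡[x-1][x+1] : ∀ x → x * x - + 1 ≡ (x - + 1) * (x - - + 1)
    x²-1≡[x-1][x+1] = solve-∀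

  infix 4 _≈_ _≈M_

  -- A record rather than a synonym for + p ∣ x - y, so that x and y can be inferred.
  record _≈_ (x y : ℤ) : Set where
    constructor mk≈
    field p∣x-y : + p ∣ x - y

  ≈-refl : ∀ {x} → x ≈ x
  ≈-refl {x} = mk≈ (divides (+ 0) (x-x≡0*0 x))

  ≈-reflexive : ∀ {x y} → x ≡ y → x ≈ y
  ≈-reflexive refl = ≈-refl

  ≈-sym : ∀ {x y} → x ≈ y → y ≈ x
  ≈-sym {x} {y} (mk≈ h) = mk≈ (subst (+ p ∣_) (sym (y-x≡-1*[x-y] x y)) (∣n⇒∣m*n (- + 1) h))

  ≈-trans : ∀ {x y z} → x ≈ y → y ≈ z → x ≈ z
  ≈-trans {x} {y} {z} (mk≈ h) (mk≈ k) = mk≈ (subst (+ p ∣_) (sym (x-z≡[x-y]+[y-z] x y z)) (∣m∣n⇒∣m+n h k))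

  +-cong : ∀ {x y x' y'} → x ≈ x' → y ≈ y' → x + y ≈ x' + y'
  +-cong {x} {y} {x'} {y'} (mk≈ h) (mk≈ k) =
    mk≈ (subst (+ p ∣_) (sym ([x+y]-[x'+y']≡[x-x']+[y-y'] x y x' y')) (∣m∣n⇒∣m+n h k))

  *-cong : ∀ {x y x' y'} → x ≈ x' → y ≈ y' → x * y ≈ x' * y'
  *-cong {x} {y} {x'} {y'} (mk≈ h) (mk≈ k) =
    mk≈ (subst (+ p ∣_) (sym (xy-x'y'≡x[y-y']+[x-x']y' x y x' y')) (∣m∣n⇒∣m+n (∣n⇒∣m*n x k) (∣m⇒∣m*n y' h)))

  -‿cong : ∀ {x y} → x ≈ y → - x ≈ - y
  -‿cong {x} {y} (mk≈ h) = mk≈ (subst (+ p ∣_) (sym ([-x]-[-y]≡-[x-y] x y)) (∣m⇒∣-m h))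

  ∣⇒≈0 : ∀ {x} → + p ∣ x → x ≈ + 0
  ∣⇒≈0 {x} h = mk≈ (subst (+ p ∣_) (sym (x-0≡x x)) h)

  ≈0⇒∣ : ∀ {x} → x ≈ + 0 → + p ∣ x
  ≈0⇒∣ {x} (mk≈ h) = subst (+ p ∣_) (x-0≡x x) h

  ≡[p]⇒≈ : ∀ {x y} → x ≡[ p ] y → x ≈ y
  ≡[p]⇒≈ h = mk≈ (∣ᵤ⇒∣ h)

  ≈⇒≡[p] : ∀ {x y} → x ≈ y → x ≡[ p ] y
  ≈⇒≡[p] (mk≈ h) = ∣⇒∣ᵤ h

  Is±1 : ℤ → Set
  Is±1 x = x ≈ + 1 ⊎ x ≈ - + 1

  Is±1-respˡ : ∀ {x y} → x ≈ y → Is±1 y → Is±1 x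
  Is±1-respˡ x≈y = map (≈-trans x≈y) (≈-trans x≈y)

  Is±1-neg : ∀ {x} → Is±1 (- x) → Is±1 x
  Is±1-neg {x} (inj₁ -x≈1)  = inj₂ (≈-trans (≈-reflexive (sym (neg-involutive x))) (-‿cong -x≈1))
  Is±1-neg {x} (inj₂ -x≈-1) = inj₁ (≈-trans (≈-reflexive (sym (neg-involutive x))) (-‿cong -x≈-1))

  Is±1⇒p∣x²-1 : ∀ {x} → Is±1 x → + p ∣ x * x - + 1
  Is±1⇒p∣x²-1 {x} (inj₁ (mk≈ p∣x-1)) = subst (+ p ∣_) (sym (x²-1≡[x-1][x+1] x)) (∣m⇒∣m*n (x - - + 1) p∣x-1)
  Is±1⇒p∣x²-1 {x} (inj₂ (mk≈ p∣x+1)) = subst (+ p ∣_) (sym (x²-1≡[x-1][x+1] x)) (∣n⇒∣m*n (x - + 1) p∣x+1)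

  p∣x²-1⇒Is±1 : Prime p → ∀ {x} → + p ∣ x * x - + 1 → Is±1 x
  p∣x²-1⇒Is±1 p-prime {x} p∣x²-1 =
    map mk≈ mk≈ (prime∣i*j⇒∣ p-prime (x - + 1) (x - - + 1) (subst (+ p ∣_) (x²-1≡[x-1][x+1] x) p∣x²-1))

  _≈M_ : Mat → Mat → Set
  mat a b c d ≈M mat a' b' c' d' = a ≈ a' × b ≈ b' × c ≈ c' × d ≈ d'

  ⊗-cong : ∀ {A A' B B'} → A ≈M A' → B ≈M B' → A ⊗ B ≈M A' ⊗ B'
  ⊗-cong {mat _ _ _ _} {mat _ _ _ _} {mat _ _ _ _} {mat _ _ _ _} (a , b , c , d) (e , f , g , h) =
    ab+cd a e b g , ab+cd a f b h , ab+cd c e d g , ab+cd c f d h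
    where
    ab+cd : ∀ {a b c d a' b' c' d'} → a ≈ a' → b ≈ b' → c ≈ c' → d ≈ d' → a * b + c * d ≈ a' * b' + c' * d'
    ab+cd a b c d = +-cong (*-cong a b) (*-cong c d)

  M-cong : ∀ {xs ys} → xs ≈L[ p ] ys → M xs ≈M M ys
  M-cong = foldl-cong (≈-refl , ≈-refl , ≈-refl , ≈-refl)
    where
    foldl-cong : ∀ {A B xs ys} → A ≈M B → xs ≈L[ p ] ys →
                 foldl (λ acc a → Elem a ⊗ acc) A xs ≈M foldl (λ acc a → Elem a ⊗ acc) B ys
    foldl-cong A≈B []                                = A≈B
    foldl-cong {xs = x ∷ _} {y ∷ _} A≈B (x≈y ∷ xs≈ys) =
      foldl-cong (⊗-cong {Elem x} {Elem y} (≡[p]⇒≈ x≈y , ≈-refl , ≈-refl , ≈-refl) A≈B) xs≈ys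

  m11-cong : ∀ {A B} → A ≈M B → Mat.m11 A ≈ Mat.m11 B
  m11-cong {mat _ _ _ _} {mat _ _ _ _} (a≈a' , _) = a≈a'

  ±Id⇒m22-Is±1 : ∀ A → (A ≈M[ p ] Id) ⊎ (A ≈M[ p ] negM Id) → Is±1 (Mat.m22 A)
  ±Id⇒m22-Is±1 (mat _ _ _ _) (inj₁ (_ , _ , _ , d≈1))  = inj₁ (≡[p]⇒≈ d≈1)
  ±Id⇒m22-Is±1 (mat _ _ _ _) (inj₂ (_ , _ , _ , d≈-1)) = inj₂ (≡[p]⇒≈ d≈-1)

  ±Id⇒m21≈0 : ∀ A → (A ≈M[ p ] Id) ⊎ (A ≈M[ p ] negM Id) → Mat.m21 A ≈ + 0
  ±Id⇒m21≈0 (mat _ _ _ _) (inj₁ (_ , _ , c≈0 , _)) = ≡[p]⇒≈ c≈0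
  ±Id⇒m21≈0 (mat _ _ _ _) (inj₂ (_ , _ , c≈0 , _)) = ≡[p]⇒≈ c≈0

module DynomialWords where

  open import Data.Nat.Base using (zero; suc; _+_; _≤_; s≤s; z≤n)
  open import Data.Nat.Properties using (+-suc; +-identityʳ; ≤-refl; m≤n⇒m≤1+n)
  open import Data.Integer.Base using (ℤ)
  open import Data.List.Base using (List; []; _∷_; _++_; drop; take; reverse; _∷ʳ_; length)
  open import Data.List.Relation.Binary.Pointwise using (Pointwise; []; _∷_)
  open import Data.List.Properties using (++-assoc; ++-identityʳ; unfold-reverse)
  open import Data.Sum using (inj₁; inj₂)
  open import Relation.Binary.PropositionalEquality
  open import Relation.Nullary using (contradiction)

  module _ (x y : ℤ) where

    dyn-++ : ∀ i j → dyn x y i ++ dyn x y j ≡ dyn x y (i + j)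
    dyn-++ zero    j = refl
    dyn-++ (suc i) j = cong (λ l → x ∷ y ∷ l) (dyn-++ i j)

    dyn-∷ʳ : ∀ j → dyn x y j ++ x ∷ y ∷ [] ≡ dyn x y (suc j)
    dyn-∷ʳ zero    = refl
    dyn-∷ʳ (suc j) = cong (λ l → x ∷ y ∷ l) (dyn-∷ʳ j)

    y∷dyn∷ʳx : ∀ j → y ∷ dyn x y j ++ x ∷ [] ≡ dyn y x (suc j)
    y∷dyn∷ʳx zero    = refl
    y∷dyn∷ʳx (suc j) = cong (λ l → y ∷ x ∷ l) (y∷dyn∷ʳx j)

  drop⁺ : ∀ {A B : Set} {R : A → B → Set} n {xs ys} → Pointwise R xs ys → Pointwise R (drop n xs) (drop n ys)
  drop⁺ zero    xs∼ys       = xs∼ys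
  drop⁺ (suc n) []          = []
  drop⁺ (suc n) (_ ∷ xs∼ys) = drop⁺ n xs∼ys

  drop-++-∷ : ∀ {A : Set} (xs : List A) z ys → drop (suc (length xs)) (xs ++ z ∷ ys) ≡ ys
  drop-++-∷ []       z ys = refl
  drop-++-∷ (x ∷ xs) z ys = drop-++-∷ xs z ys

  init'-++-last0 : ∀ x xs → x ∷ xs ≡ init' (x ∷ xs) ++ last0 (x ∷ xs) ∷ []
  init'-++-last0 x []       = refl
  init'-++-last0 x (y ∷ ys) = cong (x ∷_) (init'-++-last0 y ys)

  3≤length-dyn : ∀ x y {k} → 2 ≤ k → 3 ≤ length (dyn x y k)
  3≤length-dyn x y {suc (suc _)} _ = s≤s (s≤s (s≤s z≤n))
  3≤length-dyn x y {suc zero} (s≤s ())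

  reverse-dyn : ∀ x y j → reverse (dyn x y j) ≡ dyn y x j
  reverse-dyn x y zero    = refl
  reverse-dyn x y (suc j) = begin
    reverse (x ∷ y ∷ dyn x y j)      ≡⟨ unfold-reverse x (y ∷ dyn x y j) ⟩
    reverse (y ∷ dyn x y j) ∷ʳ x     ≡⟨ cong (_∷ʳ x) (unfold-reverse y (dyn x y j)) ⟩
    (reverse (dyn x y j) ∷ʳ y) ∷ʳ x  ≡⟨ cong (λ l → (l ∷ʳ y) ∷ʳ x) (reverse-dyn x y j) ⟩
    (dyn y x j ++ y ∷ []) ++ x ∷ []  ≡⟨ ++-assoc (dyn y x j) (y ∷ []) (x ∷ []) ⟩
    dyn y x j ++ y ∷ x ∷ []          ≡⟨ dyn-∷ʳ y x j ⟩
    dyn y x (suc j)                  ∎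
    where open ≡-Reasoning

  module _ (x y : ℤ) where

    DynUpToSwap : ℕ → List ℤ → Set
    DynUpToSwap n l = l ≡ dyn x y n ⊎ l ≡ dyn y x n

    drop++dyn++take-dyn : ∀ i k m → DynUpToSwap (k + m) (drop i (dyn x y k) ++ dyn x y m ++ take i (dyn x y k))
    drop++dyn++take-dyn zero    k m = inj₁ (trans (cong (dyn x y k ++_) (++-identityʳ (dyn x y m))) (dyn-++ x y k m))
    drop++dyn++take-dyn (suc i) zero m = inj₁ (++-identityʳ (dyn x y m))
    drop++dyn++take-dyn (suc zero) (suc k) m = inj₂ (begin
      y ∷ dyn x y k ++ dyn x y m ++ x ∷ []     ≡⟨ cong (y ∷_) (++-assoc (dyn x y k) (dyn x y m) (x ∷ [])) ⟨
      y ∷ (dyn x y k ++ dyn x y m) ++ x ∷ []   ≡⟨ cong (λ l → y ∷ l ++ x ∷ []) (dyn-++ x y k m) ⟩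
      y ∷ dyn x y (k + m) ++ x ∷ []            ≡⟨ y∷dyn∷ʳx x y (k + m) ⟩
      dyn y x (suc k + m)                      ∎)
      where open ≡-Reasoning
    drop++dyn++take-dyn (suc (suc i)) (suc k) m =
      subst₂ DynUpToSwap (+-suc k m) (cong (drop i D ++_) shift) (drop++dyn++take-dyn i k (suc m))
      where
      D : List ℤ
      D = dyn x y k
      shift : dyn x y (suc m) ++ take i D ≡ dyn x y m ++ x ∷ y ∷ take i D
      shift = trans (cong (_++ take i D) (sym (dyn-∷ʳ x y m))) (++-assoc (dyn x y m) (x ∷ y ∷ []) (take i D))

    rotate-dyn : ∀ i k → DynUpToSwap k (rotate i (dyn x y k))
    rotate-dyn i k = subst (λ n → DynUpToSwap n (rotate i (dyn x y k))) (+-identityʳ k) (drop++dyn++take-dyn i k 0)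

    data Window (k : ℕ) : List ℤ → Set where
      odd  : ∀ j → Window k (y ∷ dyn x y j)
      even : ∀ j → 2 + j ≤ k → Window k (dyn x y j)

    Window-suc : ∀ {k w} → Window k w → Window (suc k) w
    Window-suc (odd j)        = odd j
    Window-suc (even j 2+j≤k) = even j (m≤n⇒m≤1+n 2+j≤k)

    window : ∀ r k → drop (3 + r) (dyn x y k) ≢ [] → Window k (drop (3 + r) (dyn x y k))
    window zero          (suc (suc k)) _ = odd k
    window (suc zero)    (suc (suc k)) _ = even k ≤-refl
    window (suc (suc r)) (suc k) w≢[] = Window-suc (window r k w≢[])
    window zero          zero          w≢[] = contradiction refl w≢[]
    window zero          (suc zero)    w≢[] = contradiction refl w≢[]
    window (suc zero)    zero          w≢[] = contradiction refl w≢[]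
    window (suc zero)    (suc zero)    w≢[] = contradiction refl w≢[]
    window (suc (suc r)) zero          w≢[] = contradiction refl w≢[]

module Reducibility (p : ℕ) where

  open import Data.Nat.Base as ℕ using (zero; suc; _≤_; s≤s; z≤n)
  open import Data.Integer.Base using (ℤ; _+_; _*_; -_)
  open import Data.List.Base using (List; []; _∷_; drop; reverse; length)
  open import Data.Product using (∃-syntax)
  open import Data.Sum using (inj₁; inj₂; map; swap)
  open import Function using (_∘_)
  open import Relation.Binary.PropositionalEquality
  open import Relation.Nullary using (¬_; contradiction)

  open Monodromy
  open DynomialWords
  open Congruence p

  m22-M≡-m11-M-interior : ∀ b₁ b₂ bs → Mat.m22 (M (b₁ ∷ b₂ ∷ bs)) ≡ - Mat.m11 (M (init' (b₂ ∷ bs)))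
  m22-M≡-m11-M-interior b₁ b₂ bs =
    trans (cong (λ l → Mat.m22 (M (b₁ ∷ l))) (init'-++-last0 b₂ bs)) (m22-M-∷-∷ʳ b₁ (init' (b₂ ∷ bs)) _)

  -- In cs ∼ as ⊕ bs the interior of the solution bs is a suffix of the rotated word, omitting at
  -- least three letters, whose monodromy has (1,1)-entry ±1.
  record UnitCorner (cs : List ℤ) : Set where
    constructor unitCorner
    field
      r         : ℕ
      window≢[] : drop (3 ℕ.+ r) cs ≢ []
      window-±1 : Is±1 (Mat.m11 (M (drop (3 ℕ.+ r) cs)))

  ⊕-UnitCorner : ∀ {as bs cs} → Solution p bs → 3 ≤ length bs → 3 ≤ length as → (as ⊕ bs) ≈L[ p ] cs →
                 UnitCorner cs
  ⊕-UnitCorner {a₁ ∷ a₂ ∷ a₃ ∷ as} {b₁ ∷ b₂ ∷ b₃ ∷ bs} {cs} solution _ _ ⊕≈cs =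
    unitCorner r window≢[] (Is±1-respˡ (≈-sym (m11-cong (M-cong interior≈window))) interior-±1)
    where
    pre interior : List ℤ
    pre = (a₁ + last0 (b₁ ∷ b₂ ∷ b₃ ∷ bs)) ∷ init' (a₂ ∷ a₃ ∷ as)
    r : ℕ
    r = length (init' (a₃ ∷ as))
    interior = init' (b₂ ∷ b₃ ∷ bs)
    interior≈window : interior ≈L[ p ] drop (3 ℕ.+ r) cs
    interior≈window = subst (_≈L[ p ] drop (3 ℕ.+ r) cs) (drop-++-∷ pre _ interior) (drop⁺ (3 ℕ.+ r) ⊕≈cs)
    window≢[] : drop (3 ℕ.+ r) cs ≢ []
    window≢[] window≡[] with () ← subst (interior ≈L[ p ]_) window≡[] interior≈window
    interior-±1 : Is±1 (Mat.m11 (M interior))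
    interior-±1 = Is±1-neg (subst Is±1 (m22-M≡-m11-M-interior b₁ b₂ (b₃ ∷ bs))
                                       (±Id⇒m22-Is±1 (M (b₁ ∷ b₂ ∷ b₃ ∷ bs)) solution))
  ⊕-UnitCorner {bs = []}                            _ ()             _              _
  ⊕-UnitCorner {bs = _ ∷ []}                        _ (s≤s ())       _              _
  ⊕-UnitCorner {bs = _ ∷ _ ∷ []}                    _ (s≤s (s≤s ())) _              _
  ⊕-UnitCorner {[]}             {_ ∷ _ ∷ _ ∷ _} _ _              ()             _
  ⊕-UnitCorner {_ ∷ []}         {_ ∷ _ ∷ _ ∷ _} _ _              (s≤s ())       _
  ⊕-UnitCorner {_ ∷ _ ∷ []}     {_ ∷ _ ∷ _ ∷ _} _ _              (s≤s (s≤s ())) _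

  reducible⇒UnitCorner : ∀ {cs} → Reducible p cs →
                         ∃[ i ] (UnitCorner (rotate i cs) ⊎ UnitCorner (rotate i (reverse cs)))
  reducible⇒UnitCorner (as , bs , solution , 3≤|bs| , 3≤|as| , i , inj₁ ⊕≈rot) =
    i , inj₁ (⊕-UnitCorner {as} {bs} solution 3≤|bs| 3≤|as| ⊕≈rot)
  reducible⇒UnitCorner (as , bs , solution , 3≤|bs| , 3≤|as| , i , inj₂ ⊕≈rotrev) =
    i , inj₂ (⊕-UnitCorner {as} {bs} solution 3≤|bs| 3≤|as| ⊕≈rotrev)

  rotate-dyn-UnitCorner : ∀ {x y} i k → UnitCorner (rotate i (dyn x y k)) → UnitCorner (dyn x y k) ⊎ UnitCorner (dyn y x k)
  rotate-dyn-UnitCorner {x} {y} i k corner =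
    map (λ eq → subst UnitCorner eq corner) (λ eq → subst UnitCorner eq corner) (rotate-dyn x y i k)

  reducible-dyn⇒UnitCorner : ∀ a b k → Reducible p (dyn a b k) → UnitCorner (dyn a b k) ⊎ UnitCorner (dyn b a k)
  reducible-dyn⇒UnitCorner a b k red with reducible⇒UnitCorner red
  ... | i , inj₁ corner = rotate-dyn-UnitCorner i k corner
  ... | i , inj₂ corner =
    swap (rotate-dyn-UnitCorner i k (subst (λ l → UnitCorner (rotate i l)) (reverse-dyn a b k) corner))

  module _ (x y : ℤ) (k : ℕ)
           (odd-free  : ∀ j → ¬ Is±1 (y * U (tr x y) (suc j)))
           (even-free : ∀ j → 1 ≤ j → 2 ℕ.+ j ≤ k → ¬ Is±1 (U (tr x y) (suc j) + U (tr x y) j)) where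

    Window-±1-free : ∀ {w} → Window x y k w → w ≢ [] → ¬ Is±1 (Mat.m11 (M w))
    Window-±1-free (odd j)              _    = odd-free j ∘ subst Is±1 (m11-M-∷-dyn x y j)
    Window-±1-free (even zero    _)     w≢[] = contradiction refl w≢[]
    Window-±1-free (even (suc j) 2+j≤k) _    =
      even-free (suc j) (s≤s z≤n) 2+j≤k ∘ subst Is±1 (cong Mat.m11 (M-dyn x y (suc j)))

    ¬UnitCorner-dyn : ¬ UnitCorner (dyn x y k)
    ¬UnitCorner-dyn (unitCorner r w≢[] w-±1) = Window-±1-free (window x y r k w≢[]) w≢[] w-±1

module DynomialIrreducibility {p : ℕ} (p-prime : Prime p) where

  open import Data.Nat.Base as ℕ using (zero; suc; _≤_; _<_; s≤s; z≤n)
  import Data.Nat.Properties as ℕ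
  open import Data.Integer.Base using (ℤ; _+_; _-_; _*_)
  import Data.Integer.Properties as ℤ
  open import Data.Integer.Divisibility.Signed using (_∣_; ∣m⇒∣m*n; ∣n⇒∣m*n)
  open import Data.Integer.Tactic.RingSolver using (solve-∀)
  open import Data.Sum using ([_,_]′; map)
  open import Function using (_∘_)
  open import Relation.Binary.PropositionalEquality
  open import Relation.Nullary using (¬_; contradiction)

  open Monodromy
  open DynomialWords using (3≤length-dyn)
  open Congruence p
  open Reducibility p
  open IntegerPrimeDivisors using (prime∤i∧∤j⇒∤i*j)
  open QuadraticNonResidues using (QuadraticNonResidue)

  private
    1-1+z≡z : ∀ z → + 1 - + 1 + z ≡ z
    1-1+z≡z = solve-∀

  U-root⇒Solution : ∀ x y m → + p ∣ U (tr x y) m → Solution p (dyn x y m)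
  U-root⇒Solution x y m p∣u =
    map scalar scalar (p∣x²-1⇒Is±1 p-prime (subst (+ p ∣_) (sym v²-1≡u[tv-u]) (∣m⇒∣m*n (t * v - u) p∣u)))
    where
    open ≡-Reasoning
    t u v : ℤ
    t = tr x y
    u = U t m
    v = U t (suc m)
    expand : ∀ t u v → v * v - + 1 ≡ (v * v - t * v * u + u * u) - + 1 + u * (t * v - u)
    expand = solve-∀
    v²-1≡u[tv-u] : v * v - + 1 ≡ u * (t * v - u)
    v²-1≡u[tv-u] = begin
      v * v - + 1                                          ≡⟨ expand t u v ⟩
      (v * v - t * v * u + u * u) - + 1 + u * (t * v - u)  ≡⟨ cong (λ I → I - + 1 + u * (t * v - u)) (U-invariant t m) ⟩
      + 1 - + 1 + u * (t * v - u)                          ≡⟨ 1-1+z≡z _ ⟩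
      u * (t * v - u)                                      ∎
    u≈0 : u ≈ + 0
    u≈0 = ∣⇒≈0 p∣u
    c*u≈0 : ∀ c → c * u ≈ + 0
    c*u≈0 c = ≈-trans (*-cong (≈-refl {c}) u≈0) (≈-reflexive (ℤ.*-zeroʳ c))
    scalar : ∀ {s} → v ≈ s → M (dyn x y m) ≈M[ p ] mat s (+ 0) (+ 0) s
    scalar {s} v≈s rewrite M-dyn x y m =
        ≈⇒≡[p] (≈-trans (+-cong v≈s u≈0) (≈-reflexive (ℤ.+-identityʳ s)))
      , ≈⇒≡[p] (-‿cong (c*u≈0 y))
      , ≈⇒≡[p] (c*u≈0 x)
      , ≈⇒≡[p] (≈-trans (+-cong v≈s (-‿cong (c*u≈0 (x * y - + 1)))) (≈-reflexive (ℤ.+-identityʳ s)))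

  dynMinimal⇒U≢0 : ∀ {a b k} → IsDynMinimal p a b k → ∀ m → 1 ≤ m → m < k → ¬ + p ∣ U (tr a b) m
  dynMinimal⇒U≢0 {a} {b} (_ , _ , minimal) m 1≤m m<k = minimal m 1≤m m<k ∘ U-root⇒Solution a b m

  dynMinimal⇒2≤k : ∀ {a b k} → ¬ + p ∣ a → IsDynMinimal p a b k → 2 ≤ k
  dynMinimal⇒2≤k {k = zero}        _   (() , _)
  dynMinimal⇒2≤k {a} {b} {k = 1}   p∤a (_ , solution , _) = contradiction (≈0⇒∣ a≈0) p∤a
    where
    a≈0 : a ≈ + 0
    a≈0 = subst (_≈ + 0) (trans (cong Mat.m21 (M-dyn a b 1)) (ℤ.*-identityʳ a)) (±Id⇒m21≈0 (M (dyn a b 1)) solution)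
  dynMinimal⇒2≤k {k = suc (suc _)} _   _ = s≤s (s≤s z≤n)

  even-±1⇒p∣xyUU : ∀ x y j → Is±1 (U (tr x y) (suc j) + U (tr x y) j) →
                   + p ∣ x * y * U (tr x y) j * U (tr x y) (suc j)
  even-±1⇒p∣xyUU x y j ±1 = subst (+ p ∣_) [v+u]²-1≡xyuv (Is±1⇒p∣x²-1 ±1)
    where
    open ≡-Reasoning
    t u v : ℤ
    t = tr x y
    u = U t j
    v = U t (suc j)
    expand : ∀ x y u v → (v + u) * (v + u) - + 1 ≡ (v * v - (x * y - + 2) * v * u + u * u) - + 1 + x * y * u * v
    expand = solve-∀
    [v+u]²-1≡xyuv : (v + u) * (v + u) - + 1 ≡ x * y * u * v
    [v+u]²-1≡xyuv = begin
      (v + u) * (v + u) - + 1                            ≡⟨ expand x y u v ⟩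
      (v * v - t * v * u + u * u) - + 1 + x * y * u * v  ≡⟨ cong (λ I → I - + 1 + x * y * u * v) (U-invariant t j) ⟩
      + 1 - + 1 + x * y * u * v                          ≡⟨ 1-1+z≡z _ ⟩
      x * y * u * v                                      ∎

  even-±1-free : ∀ {x y k} → ¬ + p ∣ x → ¬ + p ∣ y → (∀ m → 1 ≤ m → m < k → ¬ + p ∣ U (tr x y) m) →
                 ∀ j → 1 ≤ j → 2 ℕ.+ j ≤ k → ¬ Is±1 (U (tr x y) (suc j) + U (tr x y) j)
  even-±1-free {x} {y} p∤x p∤y U≢0 j 1≤j 2+j≤k =
    prime∤i∧∤j⇒∤i*j p-prime
      (prime∤i∧∤j⇒∤i*j p-prime (prime∤i∧∤j⇒∤i*j p-prime p∤x p∤y) (U≢0 j 1≤j (ℕ.<⇒≤ 2+j≤k)))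
      (U≢0 (suc j) (s≤s z≤n) 2+j≤k)
    ∘ even-±1⇒p∣xyUU x y j

  -- When y U_m ≡ ±1 (mod p), this squares to 4y² + t² − 4 modulo p.
  sqrtWitness : ℤ → ℤ → ℕ → ℤ
  sqrtWitness y t m = y * (+ 2 * U t (suc m) - t * U t m)

  odd-±1⇒p∣W²-D : ∀ y t m → Is±1 (y * U t m) →
                  + p ∣ sqrtWitness y t m * sqrtWitness y t m - (+ 4 * y * y + (t * t - + 4))
  odd-±1⇒p∣W²-D y t m ±1 = subst (+ p ∣_) (sym W²-D≡[t²-4][y²u²-1]) (∣n⇒∣m*n (t * t - + 4) (Is±1⇒p∣x²-1 ±1))
    where
    open ≡-Reasoning
    u v : ℤ
    u = U t m
    v = U t (suc m)
    expand : ∀ y t u v → (y * (+ 2 * v - t * u)) * (y * (+ 2 * v - t * u)) - (+ 4 * y * y + (t * t - + 4))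
                         ≡ + 4 * y * y * ((v * v - t * v * u + u * u) - + 1) + (t * t - + 4) * ((y * u) * (y * u) - + 1)
    expand = solve-∀
    4y²[1-1]+z≡z : ∀ y z → + 4 * y * y * (+ 1 - + 1) + z ≡ z
    4y²[1-1]+z≡z = solve-∀
    W²-D≡[t²-4][y²u²-1] : sqrtWitness y t m * sqrtWitness y t m - (+ 4 * y * y + (t * t - + 4))
                          ≡ (t * t - + 4) * ((y * u) * (y * u) - + 1)
    W²-D≡[t²-4][y²u²-1] = begin
      _ ≡⟨ expand y t u v ⟩
      + 4 * y * y * ((v * v - t * v * u + u * u) - + 1) + (t * t - + 4) * ((y * u) * (y * u) - + 1)
        ≡⟨ cong (λ I → + 4 * y * y * (I - + 1) + (t * t - + 4) * ((y * u) * (y * u) - + 1)) (U-invariant t m) ⟩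
      + 4 * y * y * (+ 1 - + 1) + (t * t - + 4) * ((y * u) * (y * u) - + 1)
        ≡⟨ 4y²[1-1]+z≡z y _ ⟩
      (t * t - + 4) * ((y * u) * (y * u) - + 1) ∎

  odd-±1-free : ∀ {c e} y t → QuadraticNonResidue p c → ¬ + p ∣ e →
                + 4 * y * y + (t * t - + 4) ≡ e * e * + c → ∀ m → ¬ Is±1 (y * U t m)
  odd-±1-free y t nonResidue p∤e D≡e²c m =
    nonResidue _ (sqrtWitness y t m) p∤e ∘ subst (λ D → + p ∣ sqrtWitness y t m * sqrtWitness y t m - D) D≡e²c
    ∘ odd-±1⇒p∣W²-D y t m

  tr-comm : ∀ x y → tr y x ≡ tr x y
  tr-comm x y = cong (_- + 2) (ℤ.*-comm y x)

  module _ {a b : ℤ} (p∤a : ¬ + p ∣ a) (p∤b : ¬ + p ∣ b)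
           (a-odd-free : ∀ m → ¬ Is±1 (a * U (tr a b) m))
           (b-odd-free : ∀ m → ¬ Is±1 (b * U (tr a b) m)) where

    dynMinimal⇒Irreducible : ∀ k → IsDynMinimal p a b k → Irreducible p (dyn a b k)
    dynMinimal⇒Irreducible k minimal@(_ , solution , _) =
        solution
      , 3≤length-dyn a b (dynMinimal⇒2≤k p∤a minimal)
      , [ ¬UnitCorner-dyn a b k (b-odd-free ∘ suc) (even-±1-free p∤a p∤b U≢0)
        , ¬UnitCorner-dyn b a k (a-odd-free′ ∘ suc) (even-±1-free p∤b p∤a U′≢0) ]′
        ∘ reducible-dyn⇒UnitCorner a b k
      where
      U≢0 : ∀ m → 1 ≤ m → m < k → ¬ + p ∣ U (tr a b) m
      U≢0 = dynMinimal⇒U≢0 minimal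
      U′≢0 : ∀ m → 1 ≤ m → m < k → ¬ + p ∣ U (tr b a) m
      U′≢0 rewrite tr-comm a b = U≢0
      a-odd-free′ : ∀ m → ¬ Is±1 (a * U (tr b a) m)
      a-odd-free′ rewrite tr-comm a b = a-odd-free

module AtPrimes≡±7[24] {p : ℕ} (p-prime : Prime p) (p≡±7 : ModularObstruction.≡±7[24] p) where

  open import Data.Nat.Divisibility using (_∣?_)
  open import Data.Nat.Primality using (prime?)
  open import Data.Integer.Divisibility.Signed using (_∣_)
  open import Relation.Nullary using (¬_)
  open import Relation.Nullary.Decidable using (from-yes; from-no)

  open Descent using (A*A≡q*d*B*B⇒B≡0)
  open ModularObstruction using (≡±7[24]⇒7≤; 3*B*B≢A*A+j*q; 6*B*B≢A*A+j*q)
  open IntegerPrimeDivisors using (n<7≤p⇒p∤n; prime∤i∧∤j⇒∤i*j)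
  open QuadraticNonResidues using (QuadraticNonResidue; nonResidue)

  3-prime : Prime 3
  3-prime = from-yes (prime? 3)

  3-nonResidue : QuadraticNonResidue p 3
  3-nonResidue = nonResidue p-prime (A*A≡q*d*B*B⇒B≡0 3-prime {1} (from-no (3 ∣? 1))) (3*B*B≢A*A+j*q p p≡±7)

  6-nonResidue : QuadraticNonResidue p 6
  6-nonResidue = nonResidue p-prime (A*A≡q*d*B*B⇒B≡0 3-prime {2} (from-no (3 ∣? 2))) (6*B*B≢A*A+j*q p p≡±7)

  p∤2 : ¬ + p ∣ + 2
  p∤2 = n<7≤p⇒p∤n (≡±7[24]⇒7≤ p≡±7) 2 _

  p∤4 : ¬ + p ∣ + 4
  p∤4 = n<7≤p⇒p∤n (≡±7[24]⇒7≤ p≡±7) 4 _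

  p∤5 : ¬ + p ∣ + 5
  p∤5 = n<7≤p⇒p∤n (≡±7[24]⇒7≤ p≡±7) 5 _

  p∤6 : ¬ + p ∣ + 6
  p∤6 = n<7≤p⇒p∤n (≡±7[24]⇒7≤ p≡±7) 6 _

  p∤10 : ¬ + p ∣ + 10
  p∤10 = prime∤i∧∤j⇒∤i*j p-prime p∤2 p∤5

  p∤20 : ¬ + p ∣ + 20
  p∤20 = prime∤i∧∤j⇒∤i*j p-prime p∤4 p∤5

  p∤30 : ¬ + p ∣ + 30
  p∤30 = prime∤i∧∤j⇒∤i*j p-prime p∤5 p∤6

open Monodromy using (tr)
open DynomialIrreducibility using (dynMinimal⇒Irreducible; odd-±1-free)

proposition5p9 : (p : ℕ) → Prime p → ((p % 24 ≡ 7) ⊎ (p % 24 ≡ 17)) →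
    ((k : ℕ) → IsDynMinimal p (+ 2) (+ 4) k → Irreducible p (dyn (+ 2) (+ 4) k))
    × ((k : ℕ) → IsDynMinimal p (+ 5) (+ 10) k → Irreducible p (dyn (+ 5) (+ 10) k))
proposition5p9 p p-prime p≡±7 =
    dynMinimal⇒Irreducible p-prime p∤2 p∤4
      (odd-±1-free p-prime (+ 2) (tr (+ 2) (+ 4)) 3-nonResidue p∤4 refl)
      (odd-±1-free p-prime (+ 4) (tr (+ 2) (+ 4)) 6-nonResidue p∤4 refl)
  , dynMinimal⇒Irreducible p-prime p∤5 p∤10
      (odd-±1-free p-prime (+ 5)  (tr (+ 5) (+ 10)) 6-nonResidue p∤20 refl)
      (odd-±1-free p-prime (+ 10) (tr (+ 5) (+ 10)) 3-nonResidue p∤30 refl)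
  where open AtPrimes≡±7[24] p-prime p≡±7
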